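{- A graph $G$ is $Tr_3^{(v,e)}$-critical if and only if $G\cong K_3$ or $G\cong P_4$.
   Context: All graphs are finite and simple; $P_4$ is the path on four vertices. For disjoint $A,B\subseteq V$, $A$ dominates $B$ if every vertex of $B$ is adjacent to at least one vertex of $A$. A transitive $k$-partition of $G=(V,E)$ is a partition $\{V_1,\dots,V_k\}$ of $V$ into $k$ nonempty parts such that $V_i$ dominates $V_j$ for all $1\le i<j\le k$; the transitivity $Tr(G)$ is the maximum such $k$. A graph $G=(V,E)$ is transitively vertex-edge critical if deleting any element of $V\cup E$ (deleting a vertex removes it with its incident edges) yields a graph of transitivity less than $Tr(G)$; such a graph with $Tr(G)=k$ is $Tr_k^{(v,e)}$-critical. -}

module Defs where

open import Data.Nat using (ℕ; zero; suc; _<_; _≤_)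
open import Data.Fin using (Fin; zero; suc; punchIn; _≟_)
import Data.Fin as F
open import Data.Bool using (Bool; true; false; _∧_; _∨_; not)
open import Data.Product using (Σ; ∃; _×_; _,_)
open import Relation.Nullary using (¬_)
open import Relation.Nullary.Decidable using (⌊_⌋)
open import Relation.Binary.PropositionalEquality using (_≡_)
open import Function.Bundles using (_↔_; Inverse)

record Graph : Set where
  constructor mkGraph
  field
    n   : ℕ
    adj : Fin n → Fin n → Bool

open Graph public

record IsSimple (G : Graph) : Set where
  field
    symm   : ∀ u v → adj G u v ≡ adj G v u
    irrefl : ∀ u → adj G u u ≡ false

record TransitivePartition (G : Graph) (k : ℕ) : Set where
  field
    part      : Fin (n G) → Fin k
    nonempty  : ∀ (i : Fin k) → ∃ λ v → part v ≡ i
    dominates : ∀ (i j : Fin k) → i F.< j →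
                ∀ (v : Fin (n G)) → part v ≡ j →
                ∃ λ u → (part u ≡ i) × (adj G u v ≡ true)

IsTr : Graph → ℕ → Set
IsTr G k = TransitivePartition G k × (∀ m → TransitivePartition G m → m ≤ k)

TrLess : Graph → ℕ → Set
TrLess G k = ∀ m → IsTr G m → m < k

deleteVertex : (G : Graph) → Fin (n G) → Graph
deleteVertex (mkGraph zero a) ()
deleteVertex (mkGraph (suc m) a) v =
  mkGraph m (λ x y → a (punchIn v x) (punchIn v y))

deleteEdge : (G : Graph) → Fin (n G) → Fin (n G) → Graph
deleteEdge G u v = mkGraph (n G) (λ x y →
  adj G x y ∧ not ((⌊ x ≟ u ⌋ ∧ ⌊ y ≟ v ⌋) ∨ (⌊ x ≟ v ⌋ ∧ ⌊ y ≟ u ⌋)))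

TrCritical : ℕ → Graph → Set
TrCritical k G =
  IsTr G k ×
  ((v : Fin (n G)) → TrLess (deleteVertex G v) k) ×
  ((u v : Fin (n G)) → adj G u v ≡ true → TrLess (deleteEdge G u v) k)

_≅_ : Graph → Graph → Set
G ≅ H = Σ (Fin (n G) ↔ Fin (n H)) λ f →
  ∀ u v → adj H (Inverse.to f u) (Inverse.to f v) ≡ adj G u v

K3 : Graph
K3 = mkGraph 3 (λ x y → not ⌊ x ≟ y ⌋)

P4 : Graph
P4 = mkGraph 4 e
  where
  e : Fin 4 → Fin 4 → Bool
  e zero (suc zero) = true
  e (suc zero) zero = true
  e (suc zero) (suc (suc zero)) = true
  e (suc (suc zero)) (suc zero) = true
  e (suc (suc zero)) (suc (suc (suc zero))) = true
  e (suc (suc (suc zero))) (suc (suc zero)) = true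
  e _ _ = false

-- A transitive 3-partition exists exactly when G contains a triangle or a P4 (not necessarily
-- induced): a vertex v of the third part, its dominators u and w, and a dominator x of u in the
-- first part form the walk x-u-v-w. If G is Tr_3-critical, deleting a vertex or an edge missed
-- by such a subgraph would keep Tr ≥ 3, so the subgraph spans all of G and G is K3 or P4.
-- Conversely, K3 and P4 contain such a subgraph, have no vertex with three neighbours (which a
-- transitive 4-partition would produce), and lose every such subgraph under any deletion; these
-- finite facts are decided by evaluation and transported along the isomorphism.
module Submission where

open import Data.Bool using (true; _∧_; not)
import Data.Bool.Properties as Bool
open import Data.Empty using (⊥-elim)
open import Data.Fin using (Fin; zero; suc; punchIn; punchOut; _≟_) renaming (_<_ to _<ᶠ_)
open import Data.Fin.Properties
  using (any?; all?; punchInᵢ≢i; punchIn-injective; punchOut-injective; punchIn-punchOut; injective⇒≤)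
open import Data.Nat using (ℕ; suc; _≤_; _<_; _+_; z≤n; s≤s; _≤?_)
open import Data.Nat.Properties using (≤-refl; ≤-trans; <⇒≤; <⇒≱; ≰⇒>; m≤n+m; +-suc; +-identityʳ; +-monoˡ-≤)
open import Data.Product using (∃; ∃₂; _×_; _,_; proj₁; proj₂)
open import Data.Sum using (_⊎_; inj₁; inj₂)
open import Data.Vec using (Vec; []; _∷_; lookup)
open import Data.Vec.Relation.Unary.All using ([]; _∷_)
open import Data.Vec.Relation.Unary.Unique.Propositional using (Unique; []; _∷_)
open import Data.Vec.Relation.Unary.Unique.Propositional.Properties using (lookup-injective)
open import Function using (_∘_)
open import Function.Bundles using (Inverse; Injection; mk↔ₛ′; mk⇔)
open import Function.Definitions using (Injective)
open import Function.Properties.Inverse using (↔-sym; ↔⇒↣)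
open import Relation.Binary.PropositionalEquality
open import Relation.Nullary using (Dec; yes; no; ¬_; ¬?; contradiction)
open import Relation.Nullary.Decidable using (map′; _×-dec_; _⊎-dec_; _→-dec_; from-yes; dec-true; dec-false; does; isYes≗does)
open import Defs

-- Triangles, P4s and claws

-- The walk x-u-v-w with any three consecutive vertices distinct: a P4 if x ≢ w, a triangle if x ≡ w.
record IsTriangleOrP4 (G : Graph) (x u v w : Fin (n G)) : Set where
  field
    xu  : adj G x u ≡ true
    uv  : adj G u v ≡ true
    wv  : adj G w v ≡ true
    x≢u : x ≢ u
    x≢v : x ≢ v
    u≢v : u ≢ v
    u≢w : u ≢ w
    v≢w : v ≢ w

TriangleOrP4 : Graph → Set
TriangleOrP4 G = ∃ λ x → ∃ λ u → ∃ λ v → ∃ λ w → IsTriangleOrP4 G x u v w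

record IsClaw (G : Graph) (z a b c : Fin (n G)) : Set where
  field
    az  : adj G a z ≡ true
    bz  : adj G b z ≡ true
    cz  : adj G c z ≡ true
    a≢b : a ≢ b
    a≢c : a ≢ c
    b≢c : b ≢ c

Claw : Graph → Set
Claw G = ∃ λ z → ∃ λ a → ∃ λ b → ∃ λ c → IsClaw G z a b c

isTriangleOrP4? : ∀ G x u v w → Dec (IsTriangleOrP4 G x u v w)
isTriangleOrP4? G x u v w = map′
  (λ (xu , uv , wv , x≢u , x≢v , u≢v , u≢w , v≢w) → record
     { xu = xu ; uv = uv ; wv = wv ; x≢u = x≢u ; x≢v = x≢v ; u≢v = u≢v ; u≢w = u≢w ; v≢w = v≢w })
  (λ t → let open IsTriangleOrP4 t in xu , uv , wv , x≢u , x≢v , u≢v , u≢w , v≢w)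
  (adj G x u Bool.≟ true ×-dec adj G u v Bool.≟ true ×-dec adj G w v Bool.≟ true ×-dec
   ¬? (x ≟ u) ×-dec ¬? (x ≟ v) ×-dec ¬? (u ≟ v) ×-dec ¬? (u ≟ w) ×-dec ¬? (v ≟ w))

triangleOrP4? : ∀ G → Dec (TriangleOrP4 G)
triangleOrP4? G = any? λ x → any? λ u → any? λ v → any? λ w → isTriangleOrP4? G x u v w

isClaw? : ∀ G z a b c → Dec (IsClaw G z a b c)
isClaw? G z a b c = map′
  (λ (az , bz , cz , a≢b , a≢c , b≢c) → record
     { az = az ; bz = bz ; cz = cz ; a≢b = a≢b ; a≢c = a≢c ; b≢c = b≢c })
  (λ t → let open IsClaw t in az , bz , cz , a≢b , a≢c , b≢c)
  (adj G a z Bool.≟ true ×-dec adj G b z Bool.≟ true ×-dec adj G c z Bool.≟ true ×-dec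
   ¬? (a ≟ b) ×-dec ¬? (a ≟ c) ×-dec ¬? (b ≟ c))

claw? : ∀ G → Dec (Claw G)
claw? G = any? λ z → any? λ a → any? λ b → any? λ c → isClaw? G z a b c

-- Subgraph embeddings and deletions

record Embedding (G H : Graph) : Set where
  field
    map       : Fin (n G) → Fin (n H)
    injective : Injective _≡_ _≡_ map
    adj-true  : ∀ {s t} → adj G s t ≡ true → adj H (map s) (map t) ≡ true

embed-triangleOrP4 : ∀ {G H} → Embedding G H → TriangleOrP4 G → TriangleOrP4 H
embed-triangleOrP4 e (x , u , v , w , t) = map x , map u , map v , map w , record
  { xu = adj-true xu ; uv = adj-true uv ; wv = adj-true wv
  ; x≢u = x≢u ∘ injective ; x≢v = x≢v ∘ injective ; u≢v = u≢v ∘ injective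
  ; u≢w = u≢w ∘ injective ; v≢w = v≢w ∘ injective }
  where open Embedding e ; open IsTriangleOrP4 t

embed-claw : ∀ {G H} → Embedding G H → Claw G → Claw H
embed-claw e (z , a , b , c , k) = map z , map a , map b , map c , record
  { az = adj-true az ; bz = adj-true bz ; cz = adj-true cz
  ; a≢b = a≢b ∘ injective ; a≢c = a≢c ∘ injective ; b≢c = b≢c ∘ injective }
  where open Embedding e ; open IsClaw k

≅-sym : ∀ {G H} → G ≅ H → H ≅ G
≅-sym {G} {H} (f , pres) = ↔-sym f , λ i j → begin
  adj G (from i) (from j)             ≡⟨ pres (from i) (from j) ⟨
  adj H (to (from i)) (to (from j))   ≡⟨ cong₂ (adj H) (strictlyInverseˡ i) (strictlyInverseˡ j) ⟩
  adj H i j                           ∎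
  where open Inverse f ; open ≡-Reasoning

≅⇒embedding : ∀ {G H} → G ≅ H → Embedding G H
≅⇒embedding (f , pres) = record
  { map = Inverse.to f
  ; injective = Injection.injective (↔⇒↣ f)
  ; adj-true = λ {s} {t} st → trans (pres s t) st }

punchOut-adj : ∀ {m a} {y s t : Fin (suc m)} (y≢s : y ≢ s) (y≢t : y ≢ t) →
  adj (deleteVertex (mkGraph (suc m) a) y) (punchOut y≢s) (punchOut y≢t) ≡ a s t
punchOut-adj {a = a} y≢s y≢t = cong₂ a (punchIn-punchOut y≢s) (punchIn-punchOut y≢t)

deleteVertex-embedding : ∀ {G H} (e : Embedding G H) (y : Fin (n G)) →
  Embedding (deleteVertex G y) (deleteVertex H (Embedding.map e y))
deleteVertex-embedding {mkGraph (suc _) _} {mkGraph (suc _) b} e y = record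
  { map = λ s → punchOut (avoids s)
  ; injective = punchIn-injective y _ _ ∘ injective ∘ punchOut-injective (avoids _) (avoids _)
  ; adj-true = λ {s} {t} st → trans (punchOut-adj {a = b} (avoids s) (avoids t)) (adj-true st) }
  where
  open Embedding e
  avoids : ∀ s → map y ≢ map (punchIn y s)
  avoids s = punchInᵢ≢i y s ∘ injective ∘ sym
deleteVertex-embedding {mkGraph (suc _) _} {mkGraph 0 _} e y with Embedding.map e y
... | ()

avoiding⇒deleteVertex : ∀ {G} y {x u v w} → y ≢ x → y ≢ u → y ≢ v → y ≢ w →
  IsTriangleOrP4 G x u v w → TriangleOrP4 (deleteVertex G y)
avoiding⇒deleteVertex {mkGraph (suc _) a} y y≢x y≢u y≢v y≢w t =
  punchOut y≢x , punchOut y≢u , punchOut y≢v , punchOut y≢w , record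
  { xu = trans (punchOut-adj {a = a} y≢x y≢u) xu
  ; uv = trans (punchOut-adj {a = a} y≢u y≢v) uv
  ; wv = trans (punchOut-adj {a = a} y≢w y≢v) wv
  ; x≢u = x≢u ∘ punchOut-injective y≢x y≢u ; x≢v = x≢v ∘ punchOut-injective y≢x y≢v
  ; u≢v = u≢v ∘ punchOut-injective y≢u y≢v ; u≢w = u≢w ∘ punchOut-injective y≢u y≢w
  ; v≢w = v≢w ∘ punchOut-injective y≢v y≢w }
  where open IsTriangleOrP4 t

SameEdge : ∀ {m} → Fin m → Fin m → Fin m → Fin m → Set
SameEdge s t p q = (s ≡ p × t ≡ q) ⊎ (s ≡ q × t ≡ p)

sameEdge? : ∀ {m} (s t p q : Fin m) → Dec (SameEdge s t p q)
sameEdge? s t p q = (s ≟ p ×-dec t ≟ q) ⊎-dec (s ≟ q ×-dec t ≟ p)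

deleteEdge-adj : ∀ G p q s t →
  adj (deleteEdge G p q) s t ≡ adj G s t ∧ not (does (sameEdge? s t p q))
deleteEdge-adj G p q s t
  rewrite isYes≗does (s ≟ p) | isYes≗does (t ≟ q) | isYes≗does (s ≟ q) | isYes≗does (t ≟ p) = refl

deleteEdge-keeps : ∀ {G p q s t} → adj G s t ≡ true → ¬ SameEdge s t p q →
  adj (deleteEdge G p q) s t ≡ true
deleteEdge-keeps {G} {p} {q} {s} {t} st ¬same
  rewrite deleteEdge-adj G p q s t | st | dec-false (sameEdge? s t p q) ¬same = refl

deleteEdge-kept : ∀ {G p q s t} → adj (deleteEdge G p q) s t ≡ true →
  adj G s t ≡ true × ¬ SameEdge s t p q
deleteEdge-kept {G} {p} {q} {s} {t} st = Bool.∧-conicalˡ _ _ st′ , λ same →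
  contradiction (subst (λ b → not b ≡ true) (dec-true (sameEdge? s t p q) same) (Bool.∧-conicalʳ _ _ st′)) λ ()
  where
  st′ : adj G s t ∧ not (does (sameEdge? s t p q)) ≡ true
  st′ = trans (sym (deleteEdge-adj G p q s t)) st

deleteEdge-embedding : ∀ {G H} (e : Embedding G H) (p q : Fin (n G)) →
  Embedding (deleteEdge G p q) (deleteEdge H (Embedding.map e p) (Embedding.map e q))
deleteEdge-embedding {G} {H} e p q = record
  { map = map
  ; injective = injective
  ; adj-true = λ st → let (st , ¬same) = deleteEdge-kept {G} st in
      deleteEdge-keeps {H} (adj-true st) (¬same ∘ reflect) }
  where
  open Embedding e
  reflect : ∀ {s t} → SameEdge (map s) (map t) (map p) (map q) → SameEdge s t p q
  reflect (inj₁ (sp , tq)) = inj₁ (injective sp , injective tq)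
  reflect (inj₂ (sq , tp)) = inj₂ (injective sq , injective tp)

-- Transitive partitions

module _ {G : Graph} {k : ℕ} (tp : TransitivePartition G k) where
  open TransitivePartition tp

  different-parts⇒≢ : ∀ {a b i j} → part a ≡ i → part b ≡ j → i ≢ j → a ≢ b
  different-parts⇒≢ a∈i b∈j i≢j refl = i≢j (trans (sym a∈i) b∈j)

  partition-k≤n : k ≤ n G
  partition-k≤n = injective⇒≤ λ {i} {j} eq →
    trans (sym (proj₂ (nonempty i))) (trans (cong part eq) (proj₂ (nonempty j)))

-- Partitions have at most n G parts, so a maximal one exists; as having a transitive m-partition
-- is not decided here, the maximum is only obtained under a double negation.
partition⇒¬¬maximal : ∀ {G m} → TransitivePartition G m → ¬ ¬ ∃ λ k → m ≤ k × IsTr G k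
partition⇒¬¬maximal {G} {m} = search (n G) (m≤n+m (n G) m)
  where
  search : ∀ f {m} → n G ≤ m + f → TransitivePartition G m → ¬ ¬ ∃ λ k → m ≤ k × IsTr G k
  search 0 {m} n≤m+0 tp ¬max = ¬max (m , ≤-refl , tp , λ m′ tp′ →
    ≤-trans (partition-k≤n tp′) (subst (n G ≤_) (+-identityʳ m) n≤m+0))
  search (suc f) {m} n≤m+1+f tp ¬max = ¬max (m , ≤-refl , tp , bound)
    where
    bound : ∀ m′ → TransitivePartition G m′ → m′ ≤ m
    bound m′ tp′ with m′ ≤? m
    ... | yes m′≤m = m′≤m
    ... | no m′≰m = ⊥-elim (search f n≤m′+f tp′ λ (k , m′≤k , tr) → ¬max (k , ≤-trans (<⇒≤ m<m′) m′≤k , tr))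
      where
      m<m′ : m < m′
      m<m′ = ≰⇒> m′≰m
      n≤m′+f : n G ≤ m′ + f
      n≤m′+f = ≤-trans n≤m+1+f (subst (_≤ m′ + f) (sym (+-suc m f)) (+-monoˡ-≤ f m<m′))

trLess⇒¬partition : ∀ {G k} → TrLess G k → ¬ TransitivePartition G k
trLess⇒¬partition tr< tp = partition⇒¬¬maximal tp λ (k′ , k≤k′ , tr) → <⇒≱ (tr< k′ tr) k≤k′

partition⇒triangleOrP4 : ∀ {G k} → TransitivePartition G k → 3 ≤ k → TriangleOrP4 G
partition⇒triangleOrP4 {k = suc (suc (suc _))} tp (s≤s (s≤s (s≤s _))) =
  let (v , v∈2) = nonempty (suc (suc zero))
      (u , u∈1 , uv) = dominates (suc zero) (suc (suc zero)) (s≤s (s≤s z≤n)) v v∈2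
      (w , w∈0 , wv) = dominates zero (suc (suc zero)) (s≤s z≤n) v v∈2
      (x , x∈0 , xu) = dominates zero (suc zero) (s≤s z≤n) u u∈1
  in x , u , v , w , record
    { xu = xu ; uv = uv ; wv = wv
    ; x≢u = different-parts⇒≢ tp x∈0 u∈1 λ ()
    ; x≢v = different-parts⇒≢ tp x∈0 v∈2 λ ()
    ; u≢v = different-parts⇒≢ tp u∈1 v∈2 λ ()
    ; u≢w = different-parts⇒≢ tp u∈1 w∈0 λ ()
    ; v≢w = different-parts⇒≢ tp v∈2 w∈0 λ () }
  where open TransitivePartition tp

-- The case Δ(G) ≤ 2 of Tr(G) ≤ Δ(G) + 1.
partition⇒claw : ∀ {G k} → TransitivePartition G k → 4 ≤ k → Claw G
partition⇒claw {k = suc (suc (suc (suc _)))} tp (s≤s (s≤s (s≤s (s≤s _)))) =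
  let (z , z∈3) = nonempty (suc (suc (suc zero)))
      (a , a∈0 , az) = dominates zero (suc (suc (suc zero))) (s≤s z≤n) z z∈3
      (b , b∈1 , bz) = dominates (suc zero) (suc (suc (suc zero))) (s≤s (s≤s z≤n)) z z∈3
      (c , c∈2 , cz) = dominates (suc (suc zero)) (suc (suc (suc zero))) (s≤s (s≤s (s≤s z≤n))) z z∈3
  in z , a , b , c , record
    { az = az ; bz = bz ; cz = cz
    ; a≢b = different-parts⇒≢ tp a∈0 b∈1 λ ()
    ; a≢c = different-parts⇒≢ tp a∈0 c∈2 λ ()
    ; b≢c = different-parts⇒≢ tp b∈1 c∈2 λ () }
  where open TransitivePartition tp

module _ {G : Graph} {x u v w : Fin (n G)} (t : IsTriangleOrP4 G x u v w) where
  open IsTriangleOrP4 t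

  level : Fin (n G) → Fin 3
  level y with y ≟ v | y ≟ u
  ... | yes _ | _     = suc (suc zero)
  ... | no _  | yes _ = suc zero
  ... | no _  | no _  = zero

  level-v : level v ≡ suc (suc zero)
  level-v with v ≟ v
  ... | yes _ = refl
  ... | no v≢v = contradiction refl v≢v

  level-u : level u ≡ suc zero
  level-u with u ≟ v | u ≟ u
  ... | yes u≡v | _ = contradiction u≡v u≢v
  ... | no _ | yes _ = refl
  ... | no _ | no u≢u = contradiction refl u≢u

  level-0 : ∀ {y} → y ≢ v → y ≢ u → level y ≡ zero
  level-0 {y} y≢v y≢u with y ≟ v | y ≟ u
  ... | yes y≡v | _ = contradiction y≡v y≢v
  ... | no _ | yes y≡u = contradiction y≡u y≢u
  ... | no _ | no _ = refl

  level≡2⇒≡v : ∀ {y} → level y ≡ suc (suc zero) → y ≡ v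
  level≡2⇒≡v {y} _ with y ≟ v | y ≟ u
  level≡2⇒≡v _  | yes y≡v | _ = y≡v
  level≡2⇒≡v () | no _ | yes _
  level≡2⇒≡v () | no _ | no _

  level≡1⇒≡u : ∀ {y} → level y ≡ suc zero → y ≡ u
  level≡1⇒≡u {y} _ with y ≟ v | y ≟ u
  level≡1⇒≡u () | yes _ | _
  level≡1⇒≡u _  | no _ | yes y≡u = y≡u
  level≡1⇒≡u () | no _ | no _

  triangleOrP4⇒partition : TransitivePartition G 3
  triangleOrP4⇒partition = record { part = level ; nonempty = nonempty ; dominates = dominates }
    where
    w∈0 : level w ≡ zero
    w∈0 = level-0 (v≢w ∘ sym) (u≢w ∘ sym)
    x∈0 : level x ≡ zero
    x∈0 = level-0 x≢v x≢u
    nonempty : ∀ i → ∃ λ y → level y ≡ i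
    nonempty zero = w , w∈0
    nonempty (suc zero) = u , level-u
    nonempty (suc (suc zero)) = v , level-v
    dominates : ∀ i j → i <ᶠ j → ∀ y → level y ≡ j → ∃ λ z → level z ≡ i × adj G z y ≡ true
    dominates zero (suc zero) _ y y∈1 rewrite level≡1⇒≡u y∈1 = x , x∈0 , xu
    dominates zero (suc (suc zero)) _ y y∈2 rewrite level≡2⇒≡v y∈2 = w , w∈0 , wv
    dominates (suc zero) (suc (suc zero)) _ y y∈2 rewrite level≡2⇒≡v y∈2 = u , level-u , uv
    dominates (suc zero) (suc zero) (s≤s ())
    dominates (suc (suc zero)) (suc (suc zero)) (s≤s (s≤s ()))
    dominates (suc (suc zero)) (suc zero) (s≤s ())

trLess3⇒¬triangleOrP4 : ∀ {G} → TrLess G 3 → ¬ TriangleOrP4 G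
trLess3⇒¬triangleOrP4 tr< (_ , _ , _ , _ , t) = trLess⇒¬partition tr< (triangleOrP4⇒partition t)

¬triangleOrP4⇒trLess3 : ∀ {G} → ¬ TriangleOrP4 G → TrLess G 3
¬triangleOrP4⇒trLess3 ¬t m (tp , _) with 3 ≤? m
... | yes 3≤m = contradiction (partition⇒triangleOrP4 tp 3≤m) ¬t
... | no 3≰m = ≰⇒> 3≰m

-- Sufficient conditions for criticality

-- Decidable, hence checked on K3 and P4 by evaluation.
Tr3CriticalCertificate : Graph → Set
Tr3CriticalCertificate G =
  TriangleOrP4 G × ¬ Claw G ×
  (∀ y → ¬ TriangleOrP4 (deleteVertex G y)) ×
  (∀ a b → adj G a b ≡ true → ¬ TriangleOrP4 (deleteEdge G a b))

certificate? : ∀ G → Dec (Tr3CriticalCertificate G)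
certificate? G =
  triangleOrP4? G ×-dec ¬? (claw? G) ×-dec
  all? (λ y → ¬? (triangleOrP4? (deleteVertex G y))) ×-dec
  all? (λ a → all? λ b → (adj G a b Bool.≟ true) →-dec ¬? (triangleOrP4? (deleteEdge G a b)))

certificate⇒critical : ∀ {G} → Tr3CriticalCertificate G → TrCritical 3 G
certificate⇒critical {G} ((_ , _ , _ , _ , t) , ¬claw , ¬t-vertex , ¬t-edge) =
  (triangleOrP4⇒partition t , bound) ,
  (λ y → ¬triangleOrP4⇒trLess3 (¬t-vertex y)) ,
  (λ a b ab → ¬triangleOrP4⇒trLess3 (¬t-edge a b ab))
  where
  bound : ∀ m → TransitivePartition G m → m ≤ 3
  bound m tp with m ≤? 3
  ... | yes m≤3 = m≤3
  ... | no m≰3 = contradiction (partition⇒claw tp (≰⇒> m≰3)) ¬claw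

≅-certificate : ∀ {G H} → G ≅ H → Tr3CriticalCertificate H → Tr3CriticalCertificate G
≅-certificate {G} {H} G≅H (t , ¬claw , ¬t-vertex , ¬t-edge) =
  embed-triangleOrP4 (≅⇒embedding (≅-sym G≅H)) t ,
  ¬claw ∘ embed-claw e ,
  (λ y → ¬t-vertex (map y) ∘ embed-triangleOrP4 (deleteVertex-embedding e y)) ,
  (λ a b ab → ¬t-edge (map a) (map b) (adj-true ab) ∘ embed-triangleOrP4 (deleteEdge-embedding e a b))
  where
  e : Embedding G H
  e = ≅⇒embedding G≅H
  open Embedding e

K3-certificate : Tr3CriticalCertificate K3
K3-certificate = from-yes (certificate? K3)

P4-certificate : Tr3CriticalCertificate P4
P4-certificate = from-yes (certificate? P4)

-- Critical graphs

module _ {G : Graph} (crit : TrCritical 3 G) {x u v w : Fin (n G)} (t : IsTriangleOrP4 G x u v w) where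
  open IsTriangleOrP4 t

  critical⇒covered : ∀ y → y ≡ x ⊎ y ≡ u ⊎ y ≡ v ⊎ y ≡ w
  critical⇒covered y with y ≟ x | y ≟ u | y ≟ v | y ≟ w
  ... | yes y≡x | _ | _ | _ = inj₁ y≡x
  ... | no _ | yes y≡u | _ | _ = inj₂ (inj₁ y≡u)
  ... | no _ | no _ | yes y≡v | _ = inj₂ (inj₂ (inj₁ y≡v))
  ... | no _ | no _ | no _ | yes y≡w = inj₂ (inj₂ (inj₂ y≡w))
  ... | no y≢x | no y≢u | no y≢v | no y≢w =
    contradiction (avoiding⇒deleteVertex y y≢x y≢u y≢v y≢w t)
                  (trLess3⇒¬triangleOrP4 (proj₁ (proj₂ crit) y))

  critical⇒edges : ∀ {p q} → adj G p q ≡ true →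
    SameEdge x u p q ⊎ SameEdge u v p q ⊎ SameEdge w v p q
  critical⇒edges {p} {q} pq with sameEdge? x u p q | sameEdge? u v p q | sameEdge? w v p q
  ... | yes e | _ | _ = inj₁ e
  ... | no _ | yes e | _ = inj₂ (inj₁ e)
  ... | no _ | no _ | yes e = inj₂ (inj₂ e)
  ... | no ¬xu | no ¬uv | no ¬wv =
    contradiction (x , u , v , w , t′) (trLess3⇒¬triangleOrP4 (proj₂ (proj₂ crit) p q pq))
    where
    t′ : IsTriangleOrP4 (deleteEdge G p q) x u v w
    t′ = record
      { xu = deleteEdge-keeps {G} xu ¬xu ; uv = deleteEdge-keeps {G} uv ¬uv ; wv = deleteEdge-keeps {G} wv ¬wv
      ; x≢u = x≢u ; x≢v = x≢v ; u≢v = u≢v ; u≢w = u≢w ; v≢w = v≢w }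

listing⇒≅ : ∀ {G H} (f : Fin (n H) → Fin (n G)) → Injective _≡_ _≡_ f → (∀ y → ∃ λ i → f i ≡ y) →
  (∀ {i j} → adj H i j ≡ true → adj G (f i) (f j) ≡ true) →
  (∀ {p q} → adj G p q ≡ true → ∃₂ λ i j → f i ≡ p × f j ≡ q × adj H i j ≡ true) →
  G ≅ H
listing⇒≅ {G} {H} f f-injective f-onto edge⁺ edge⁻ =
  mk↔ₛ′ index f index-f (proj₂ ∘ f-onto) , adj-index
  where
  index : Fin (n G) → Fin (n H)
  index y = proj₁ (f-onto y)
  index-f : ∀ i → index (f i) ≡ i
  index-f i = f-injective (proj₂ (f-onto (f i)))
  adj-index : ∀ p q → adj H (index p) (index q) ≡ adj G p q
  adj-index p q = Bool.⇔→≡ (mk⇔ to from)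
    where
    to : adj H (index p) (index q) ≡ true → adj G p q ≡ true
    to pq = subst₂ (λ a b → adj G a b ≡ true) (proj₂ (f-onto p)) (proj₂ (f-onto q)) (edge⁺ pq)
    from : adj G p q ≡ true → adj H (index p) (index q) ≡ true
    from pq with edge⁻ pq
    ... | i , j , refl , refl , ij = subst₂ (λ a b → adj H a b ≡ true) (sym (index-f i)) (sym (index-f j)) ij

module _ {G : Graph} (sim : IsSimple G) (crit : TrCritical 3 G) where
  open IsSimple sim

  adj-sym : ∀ {a b} → adj G a b ≡ true → adj G b a ≡ true
  adj-sym {a} {b} ab = trans (symm b a) ab

  triangle⇒≅K3 : ∀ {x u v} → IsTriangleOrP4 G x u v x → G ≅ K3
  triangle⇒≅K3 {x} {u} {v} t = listing⇒≅ (lookup xs) (λ {i} {j} → lookup-injective distinct i j) onto edge⁺ edge⁻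
    where
    open IsTriangleOrP4 t
    xs : Vec (Fin (n G)) 3
    xs = x ∷ u ∷ v ∷ []
    distinct : Unique xs
    distinct = (x≢u ∷ x≢v ∷ []) ∷ (u≢v ∷ []) ∷ [] ∷ []
    onto : ∀ y → ∃ λ i → lookup xs i ≡ y
    onto y with critical⇒covered crit t y
    ... | inj₁ refl = zero , refl
    ... | inj₂ (inj₁ refl) = suc zero , refl
    ... | inj₂ (inj₂ (inj₁ refl)) = suc (suc zero) , refl
    ... | inj₂ (inj₂ (inj₂ refl)) = zero , refl
    edge⁺ : ∀ {i j} → adj K3 i j ≡ true → adj G (lookup xs i) (lookup xs j) ≡ true
    edge⁺ {zero} {suc zero} _ = xu
    edge⁺ {zero} {suc (suc zero)} _ = wv
    edge⁺ {suc zero} {zero} _ = adj-sym xu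
    edge⁺ {suc zero} {suc (suc zero)} _ = uv
    edge⁺ {suc (suc zero)} {zero} _ = adj-sym wv
    edge⁺ {suc (suc zero)} {suc zero} _ = adj-sym uv
    edge⁺ {zero} {zero} ()
    edge⁺ {suc zero} {suc zero} ()
    edge⁺ {suc (suc zero)} {suc (suc zero)} ()
    edge⁻ : ∀ {p q} → adj G p q ≡ true → ∃₂ λ i j → lookup xs i ≡ p × lookup xs j ≡ q × adj K3 i j ≡ true
    edge⁻ pq with critical⇒edges crit t pq
    ... | inj₁ (inj₁ (refl , refl)) = zero , suc zero , refl , refl , refl
    ... | inj₁ (inj₂ (refl , refl)) = suc zero , zero , refl , refl , refl
    ... | inj₂ (inj₁ (inj₁ (refl , refl))) = suc zero , suc (suc zero) , refl , refl , refl
    ... | inj₂ (inj₁ (inj₂ (refl , refl))) = suc (suc zero) , suc zero , refl , refl , refl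
    ... | inj₂ (inj₂ (inj₁ (refl , refl))) = zero , suc (suc zero) , refl , refl , refl
    ... | inj₂ (inj₂ (inj₂ (refl , refl))) = suc (suc zero) , zero , refl , refl , refl

  path⇒≅P4 : ∀ {x u v w} → x ≢ w → IsTriangleOrP4 G x u v w → G ≅ P4
  path⇒≅P4 {x} {u} {v} {w} x≢w t = listing⇒≅ (lookup xs) (λ {i} {j} → lookup-injective distinct i j) onto edge⁺ edge⁻
    where
    open IsTriangleOrP4 t
    xs : Vec (Fin (n G)) 4
    xs = x ∷ u ∷ v ∷ w ∷ []
    distinct : Unique xs
    distinct = (x≢u ∷ x≢v ∷ x≢w ∷ []) ∷ (u≢v ∷ u≢w ∷ []) ∷ (v≢w ∷ []) ∷ [] ∷ []
    onto : ∀ y → ∃ λ i → lookup xs i ≡ y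
    onto y with critical⇒covered crit t y
    ... | inj₁ refl = zero , refl
    ... | inj₂ (inj₁ refl) = suc zero , refl
    ... | inj₂ (inj₂ (inj₁ refl)) = suc (suc zero) , refl
    ... | inj₂ (inj₂ (inj₂ refl)) = suc (suc (suc zero)) , refl
    edge⁺ : ∀ {i j} → adj P4 i j ≡ true → adj G (lookup xs i) (lookup xs j) ≡ true
    edge⁺ {zero} {suc zero} _ = xu
    edge⁺ {suc zero} {zero} _ = adj-sym xu
    edge⁺ {suc zero} {suc (suc zero)} _ = uv
    edge⁺ {suc (suc zero)} {suc zero} _ = adj-sym uv
    edge⁺ {suc (suc zero)} {suc (suc (suc zero))} _ = adj-sym wv
    edge⁺ {suc (suc (suc zero))} {suc (suc zero)} _ = wv
    edge⁺ {zero} {zero} ()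
    edge⁺ {zero} {suc (suc _)} ()
    edge⁺ {suc zero} {suc zero} ()
    edge⁺ {suc zero} {suc (suc (suc zero))} ()
    edge⁺ {suc (suc zero)} {zero} ()
    edge⁺ {suc (suc zero)} {suc (suc zero)} ()
    edge⁺ {suc (suc (suc zero))} {zero} ()
    edge⁺ {suc (suc (suc zero))} {suc zero} ()
    edge⁺ {suc (suc (suc zero))} {suc (suc (suc zero))} ()
    edge⁻ : ∀ {p q} → adj G p q ≡ true → ∃₂ λ i j → lookup xs i ≡ p × lookup xs j ≡ q × adj P4 i j ≡ true
    edge⁻ pq with critical⇒edges crit t pq
    ... | inj₁ (inj₁ (refl , refl)) = zero , suc zero , refl , refl , refl
    ... | inj₁ (inj₂ (refl , refl)) = suc zero , zero , refl , refl , refl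
    ... | inj₂ (inj₁ (inj₁ (refl , refl))) = suc zero , suc (suc zero) , refl , refl , refl
    ... | inj₂ (inj₁ (inj₂ (refl , refl))) = suc (suc zero) , suc zero , refl , refl , refl
    ... | inj₂ (inj₂ (inj₁ (refl , refl))) = suc (suc (suc zero)) , suc (suc zero) , refl , refl , refl
    ... | inj₂ (inj₂ (inj₂ (refl , refl))) = suc (suc zero) , suc (suc (suc zero)) , refl , refl , refl

  critical⇒≅K3⊎≅P4 : (G ≅ K3) ⊎ (G ≅ P4)
  critical⇒≅K3⊎≅P4 with partition⇒triangleOrP4 (proj₁ (proj₁ crit)) ≤-refl
  ... | x , u , v , w , t with x ≟ w
  ...   | yes refl = inj₁ (triangle⇒≅K3 t)
  ...   | no x≢w = inj₂ (path⇒≅P4 x≢w t)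

corollary2 : (G : Graph) → IsSimple G →
    (TrCritical 3 G → (G ≅ K3) ⊎ (G ≅ P4)) × (((G ≅ K3) ⊎ (G ≅ P4)) → TrCritical 3 G)
corollary2 G sim = critical⇒≅K3⊎≅P4 sim , λ where
  (inj₁ G≅K3) → certificate⇒critical (≅-certificate G≅K3 K3-certificate)
  (inj₂ G≅P4) → certificate⇒critical (≅-certificate G≅P4 P4-certificate)
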